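{- Let $p$ be a prime, $k$ an integer and $n\ge1$. Let $r$ be the size of the $(k+p^n\mathbb{Z})$-monomial minimal solution of $(E_{p^n})$. (i) The size of the $(k+p^{n+1}\mathbb{Z})$-monomial minimal solution of $(E_{p^{n+1}})$ equals $r$ or $pr$. (ii) If $p$ is odd and $r$ is even, then $M_r(\overline k,\dots,\overline k)=-\mathrm{Id}$ in $SL_2(\mathbb{Z}/p^n\mathbb{Z})$. (iii) Let $h$ be the size of the $(k+p\mathbb{Z})$-monomial minimal solution of $(E_p)$. If $p$ is odd, then $r\equiv \pm h\pmod 4$; in particular $r\equiv 2\pmod 4$ if and only if $h\equiv 2\pmod 4$.
   Context: For an integer $N\ge 2$ and $a_1,\dots,a_n\in\mathbb{Z}/N\mathbb{Z}$, set $M_n(a_1,\dots,a_n)=\begin{pmatrix}a_n&-1\\1&0\end{pmatrix}\cdots\begin{pmatrix}a_1&-1\\1&0\end{pmatrix}\in SL_2(\mathbb{Z}/N\mathbb{Z})$. The equation $(E_N)$ is $M_n(a_1,\dots,a_n)=\pm \mathrm{Id}$; an $n$-tuple satisfying it is a solution of size $n$. The $\overline k$-monomial minimal solution of $(E_N)$ is the tuple $(\overline k,\dots,\overline k)$ of the least positive length for which it solves $(E_N)$; its size is that length. -}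

module Defs where

open import Data.Nat using (ℕ; zero; suc; _≤_; _<_)
open import Data.Integer using (ℤ; +_; -_; _+_; _*_; _-_)
open import Data.Integer.Divisibility using (_∣_)
open import Data.Product using (_×_)
open import Data.Sum using (_⊎_)
open import Relation.Nullary using (¬_)

record Mat : Set where
  constructor mat
  field
    a b c d : ℤ

_⊗_ : Mat → Mat → Mat
mat a b c d ⊗ mat a' b' c' d' =
  mat (a * a' + b * c') (a * b' + b * d') (c * a' + d * c') (c * b' + d * d')

Id : Mat
Id = mat (+ 1) (+ 0) (+ 0) (+ 1)

negId : Mat
negId = mat (- + 1) (+ 0) (+ 0) (- + 1)

_≡[_]_ : ℤ → ℕ → ℤ → Set
x ≡[ N ] y = (+ N) ∣ (x - y)

-- entrywise congruence mod N, i.e. equality in M_2(ℤ/Nℤ)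
_≈[_]_ : Mat → ℕ → Mat → Set
mat a b c d ≈[ N ] mat a' b' c' d' =
  (a ≡[ N ] a') × (b ≡[ N ] b') × (c ≡[ N ] c') × (d ≡[ N ] d')

step : ℤ → Mat
step k = mat k (- + 1) (+ 1) (+ 0)

M : ℕ → ℤ → Mat
M zero    k = Id
M (suc n) k = step k ⊗ M n k

Solves : ℕ → ℤ → ℕ → Set
Solves N k n = (M n k ≈[ N ] Id) ⊎ (M n k ≈[ N ] negId)

MinSize : ℕ → ℤ → ℕ → Set
MinSize N k r = (1 ≤ r) × Solves N k r × (∀ m → 1 ≤ m → m < r → ¬ Solves N k m)

-- Monomial solutions are closed under concatenation and cancellation, since M (m + n) k = M m k ⊗ M n k
-- and ±Id is a subgroup; so every solution size is a multiple of the minimal one. If X ≡ e·Id (mod N)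
-- and q ∣ N, then X = e·Id + N·Y and the binomial theorem gives X^q ≡ e^q·Id + q e^(q-1) N·Y ≡ e^q·Id
-- (mod qN). Hence a solution of size r mod p^n yields one of size p r mod p^(n+1), and the minimal size
-- there is r or p r; likewise the minimal size mod p^n is d h with d ∣ p^(n-1), so d is odd when p is
-- and r ≡ ±h (mod 4). For odd p, a determinant-one X with X² ≡ Id (mod p^n) satisfies (tr X)·X ≡ 2·Id
-- by Cayley–Hamilton, so tr X is a unit and X ≡ ±Id: if the minimal size r = 2q had M r ≡ Id, then
-- M q would already be ±Id.

module Submission where

open import Defs
open import Data.Nat.Base as ℕ using (ℕ; zero; suc)
import Data.Nat.Properties as ℕ
import Data.Nat.Divisibility as ℕ
open import Data.Nat.Primality using (Prime; euclidsLemma; prime⇒nonZero; prime⇒irreducible; irreducible[2]; ¬prime[1])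
open import Data.Product using (Σ; _×_; _,_)
open import Data.Sum as Sum using (_⊎_; inj₁; inj₂)
open import Data.Empty using (⊥-elim)
open import Data.List.Base using (_∷_; [])
open import Function.Base using (_∘_)
open import Relation.Binary.Bundles using (Setoid)
open import Relation.Binary.PropositionalEquality using (_≡_; refl; sym; trans; cong; cong₂; subst; subst₂; module ≡-Reasoning)
open import Relation.Nullary using (¬_; yes; no)
import Relation.Binary.Reasoning.Setoid as SetoidReasoning
open import Level using (0ℓ)

-- Integer arithmetic is opened only inside this module, leaving ℕ's operators for the statement below.
module IntegerMatrices where
  open import Data.Integer.Base using (ℤ; +_; -_; _+_; _*_; _-_; _^_; ∣_∣)
  import Data.Integer.Divisibility.Signed as Signed
  import Data.Integer.Properties as ℤ
  open import Data.Integer.Tactic.RingSolver using (solve-∀; solve)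

  -- Defs' _≡[_]_ and _≈[_]_ unfold to divisibility of absolute values, from which Agda cannot infer
  -- the compared terms; the records _≡_[mod_] and _≋_[mod_] restate them with rigid indices.
  infix 4 _≡_[mod_]
  record _≡_[mod_] (x y : ℤ) (N : ℕ) : Set where
    constructor mod-by
    field
      N∣x-y : + N Signed.∣ (x - y)
  open _≡_[mod_]

  ≡[]⇒≡[mod] : ∀ {N x y} → x ≡[ N ] y → x ≡ y [mod N ]
  ≡[]⇒≡[mod] p = mod-by (Signed.∣ᵤ⇒∣ p)

  ≡[mod]⇒≡[] : ∀ {N x y} → x ≡ y [mod N ] → x ≡[ N ] y
  ≡[mod]⇒≡[] (mod-by p) = Signed.∣⇒∣ᵤ p

  mod-by-≡ : ∀ {N x y z} → + N Signed.∣ z → z ≡ x - y → x ≡ y [mod N ]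
  mod-by-≡ N∣z refl = mod-by N∣z

  ≡⇒≡[mod] : ∀ {N x y} → x ≡ y → x ≡ y [mod N ]
  ≡⇒≡[mod] {N} {x} refl = mod-by-≡ (Signed.divides (+ 0) refl) (solve (x ∷ []))

  ≡[mod]-refl : ∀ {N x} → x ≡ x [mod N ]
  ≡[mod]-refl = ≡⇒≡[mod] refl

  ≡[mod]-sym : ∀ {N x y} → x ≡ y [mod N ] → y ≡ x [mod N ]
  ≡[mod]-sym {x = x} {y} (mod-by p) = mod-by-≡ (Signed.∣m⇒∣-m p) (solve (x ∷ y ∷ []))

  ≡[mod]-trans : ∀ {N x y z} → x ≡ y [mod N ] → y ≡ z [mod N ] → x ≡ z [mod N ]
  ≡[mod]-trans {x = x} {y} {z} (mod-by p) (mod-by q) = mod-by-≡ (Signed.∣m∣n⇒∣m+n p q) (solve (x ∷ y ∷ z ∷ []))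

  ≡[mod]-+ : ∀ {N x x′ y y′} → x ≡ x′ [mod N ] → y ≡ y′ [mod N ] → x + y ≡ x′ + y′ [mod N ]
  ≡[mod]-+ {x = x} {x′} {y} {y′} (mod-by p) (mod-by q) =
    mod-by-≡ (Signed.∣m∣n⇒∣m+n p q) (solve (x ∷ x′ ∷ y ∷ y′ ∷ []))

  ≡[mod]-* : ∀ {N x x′ y y′} → x ≡ x′ [mod N ] → y ≡ y′ [mod N ] → x * y ≡ x′ * y′ [mod N ]
  ≡[mod]-* {x = x} {x′} {y} {y′} (mod-by p) (mod-by q) =
    mod-by-≡ (Signed.∣m∣n⇒∣m+n (Signed.∣m⇒∣m*n y p) (Signed.∣n⇒∣m*n x′ q)) (solve (x ∷ x′ ∷ y ∷ y′ ∷ []))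

  ≡[mod]-weaken : ∀ {M N x y} → M ℕ.∣ N → x ≡ y [mod N ] → x ≡ y [mod M ]
  ≡[mod]-weaken M∣N (mod-by p) = mod-by (Signed.∣-trans (Signed.∣ᵤ⇒∣ M∣N) p)

  ≡[mod]⇒≡+* : ∀ {N x y} → x ≡ y [mod N ] → Σ ℤ λ q → x ≡ y + + N * q
  ≡[mod]⇒≡+* {N} {x} {y} (mod-by (Signed.divides q x-y≡q*N)) = q , (begin
    x               ≡⟨ solve (x ∷ y ∷ []) ⟩
    y + (x - y)     ≡⟨ cong (_+_ y) x-y≡q*N ⟩
    y + q * + N     ≡⟨ cong (_+_ y) (ℤ.*-comm q (+ N)) ⟩
    y + + N * q     ∎)
    where open ≡-Reasoning

  ≡[mod]-by-multiple : ∀ {L m x y} z → + L Signed.∣ m → x ≡ y + m * z → x ≡ y [mod L ]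
  ≡[mod]-by-multiple {m = m} {y = y} z L∣m refl = mod-by-≡ (Signed.∣m⇒∣m*n z L∣m) (solve (y ∷ m ∷ z ∷ []))

  ≡[mod]-setoid : ℕ → Setoid 0ℓ 0ℓ
  ≡[mod]-setoid N = record
    { Carrier = ℤ
    ; _≈_ = _≡_[mod N ]
    ; isEquivalence = record { refl = ≡[mod]-refl ; sym = ≡[mod]-sym ; trans = ≡[mod]-trans }
    }

  module ≡[mod]-Reasoning (N : ℕ) = SetoidReasoning (≡[mod]-setoid N)

  -- Modulo a prime power

  p^n∣m*k⇒p^n∣k : ∀ {p m k} n → Prime p → ¬ p ℕ.∣ m → p ℕ.^ n ℕ.∣ m ℕ.* k → p ℕ.^ n ℕ.∣ k
  p^n∣m*k⇒p^n∣k zero _ _ _ = ℕ.1∣ _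
  p^n∣m*k⇒p^n∣k {p} {m} (suc n) p-prime p∤m p^[1+n]∣mk
    with euclidsLemma m _ p-prime (ℕ.∣-trans (ℕ.m∣m*n (p ℕ.^ n)) p^[1+n]∣mk)
  ... | inj₁ p∣m = ⊥-elim (p∤m p∣m)
  ... | inj₂ (ℕ.divides j refl) = subst (p ℕ.^ suc n ℕ.∣_) (ℕ.*-comm p j) (ℕ.*-monoʳ-∣ p p^n∣j)
    where
    instance _ = prime⇒nonZero p-prime
    p^n∣j : p ℕ.^ n ℕ.∣ j
    p^n∣j = p^n∣m*k⇒p^n∣k n p-prime p∤m (ℕ.*-cancelˡ-∣ p (subst (p ℕ.^ suc n ℕ.∣_) m*[j*p]≡p*[m*j] p^[1+n]∣mk))
      where
      m*[j*p]≡p*[m*j] : m ℕ.* (j ℕ.* p) ≡ p ℕ.* (m ℕ.* j)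
      m*[j*p]≡p*[m*j] = trans (sym (ℕ.*-assoc m j p)) (ℕ.*-comm (m ℕ.* j) p)

  ≡[mod]-*-cancelˡ : ∀ {p t x y} n → Prime p → ¬ + p Signed.∣ t →
                     t * x ≡ t * y [mod p ℕ.^ n ] → x ≡ y [mod p ℕ.^ n ]
  ≡[mod]-*-cancelˡ {p} {t} {x} {y} n p-prime p∤t (mod-by p^n∣tx-ty) =
    mod-by (Signed.∣ᵤ⇒∣ (p^n∣m*k⇒p^n∣k n p-prime (p∤t ∘ Signed.∣ᵤ⇒∣) p^n∣∣t∣*∣x-y∣))
    where
    tx-ty≡t*[x-y] : t * x - t * y ≡ t * (x - y)
    tx-ty≡t*[x-y] = solve (t ∷ x ∷ y ∷ [])
    p^n∣∣t∣*∣x-y∣ : p ℕ.^ n ℕ.∣ ∣ t ∣ ℕ.* ∣ x - y ∣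
    p^n∣∣t∣*∣x-y∣ = subst (p ℕ.^ n ℕ.∣_) (trans (cong ∣_∣ tx-ty≡t*[x-y]) (ℤ.abs-* t (x - y)))
                          (Signed.∣⇒∣ᵤ p^n∣tx-ty)

  odd-prime∤2 : ∀ {p} → Prime p → ¬ 2 ℕ.∣ p → ¬ + p Signed.∣ + 2
  odd-prime∤2 p-prime 2∤p p∣2 with irreducible[2] (Signed.∣⇒∣ᵤ p∣2)
  ... | inj₁ refl = ¬prime[1] p-prime
  ... | inj₂ refl = 2∤p ℕ.∣-refl

  square≡1⇒≡±1 : ∀ {p a} n → Prime p → ¬ 2 ℕ.∣ p → a * a ≡ + 1 [mod p ℕ.^ n ] →
                 a ≡ + 1 [mod p ℕ.^ n ] ⊎ a ≡ - + 1 [mod p ℕ.^ n ]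
  square≡1⇒≡±1 {p} {a} n p-prime 2∤p a²≡1 with + p Signed.∣? (a - + 1)
  ... | yes p∣a-1 = inj₁ (≡[mod]-*-cancelˡ n p-prime p∤a+1 (begin
      (a + + 1) * a   ≡⟨ solve (a ∷ []) ⟩
      a * a + a       ≈⟨ ≡[mod]-+ a²≡1 ≡[mod]-refl ⟩
      + 1 + a         ≡⟨ solve (a ∷ []) ⟩
      (a + + 1) * + 1 ∎))
    where
    open ≡[mod]-Reasoning (p ℕ.^ n)
    p∤a+1 : ¬ + p Signed.∣ a + + 1
    p∤a+1 p∣a+1 = odd-prime∤2 p-prime 2∤p
      (subst (+ p Signed.∣_) difference (Signed.∣m∣n⇒∣m-n p∣a+1 p∣a-1))
      where
      difference : (a + + 1) - (a - + 1) ≡ + 2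
      difference = solve (a ∷ [])
  ... | no p∤a-1 = inj₂ (≡[mod]-*-cancelˡ n p-prime p∤a-1 (begin
      (a - + 1) * a     ≡⟨ solve (a ∷ []) ⟩
      a * a - a         ≈⟨ ≡[mod]-+ a²≡1 ≡[mod]-refl ⟩
      + 1 - a           ≡⟨ solve (a ∷ []) ⟩
      (a - + 1) * - + 1 ∎))
    where open ≡[mod]-Reasoning (p ℕ.^ n)

  mat-cong : ∀ {a b c d a′ b′ c′ d′} → a ≡ a′ → b ≡ b′ → c ≡ c′ → d ≡ d′ →
             mat a b c d ≡ mat a′ b′ c′ d′
  mat-cong refl refl refl refl = refl

  ⊗-assoc : ∀ X Y Z → (X ⊗ Y) ⊗ Z ≡ X ⊗ (Y ⊗ Z)
  ⊗-assoc (mat a b c d) (mat e f g h) (mat i j k l) =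
    mat-cong (entry a b e f g h i k) (entry a b e f g h j l) (entry c d e f g h i k) (entry c d e f g h j l)
    where
    entry : ∀ x y e f g h u v → (x * e + y * g) * u + (x * f + y * h) * v ≡ x * (e * u + f * v) + y * (g * u + h * v)
    entry = solve-∀

  ⊗-identityˡ : ∀ X → Id ⊗ X ≡ X
  ⊗-identityˡ (mat a b c d) = mat-cong (entry a c) (entry b d) (entry′ a c) (entry′ b d)
    where
    entry : ∀ x y → + 1 * x + + 0 * y ≡ x
    entry = solve-∀
    entry′ : ∀ x y → + 0 * x + + 1 * y ≡ y
    entry′ = solve-∀

  ⊗-identityʳ : ∀ X → X ⊗ Id ≡ X
  ⊗-identityʳ (mat a b c d) = mat-cong (entry a b) (entry′ a b) (entry c d) (entry′ c d)
    where
    entry : ∀ x y → x * + 1 + y * + 0 ≡ x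
    entry = solve-∀
    entry′ : ∀ x y → x * + 0 + y * + 1 ≡ y
    entry′ = solve-∀

  infixr 25 _^ᴹ_
  _^ᴹ_ : Mat → ℕ → Mat
  X ^ᴹ zero  = Id
  X ^ᴹ suc j = X ⊗ X ^ᴹ j

  M-+ : ∀ m n k → M (m ℕ.+ n) k ≡ M m k ⊗ M n k
  M-+ zero    n k = sym (⊗-identityˡ (M n k))
  M-+ (suc m) n k = begin
    step k ⊗ M (m ℕ.+ n) k     ≡⟨ cong (step k ⊗_) (M-+ m n k) ⟩
    step k ⊗ (M m k ⊗ M n k)   ≡⟨ ⊗-assoc (step k) (M m k) (M n k) ⟨
    (step k ⊗ M m k) ⊗ M n k   ∎
    where open ≡-Reasoning

  M-* : ∀ q r k → M (q ℕ.* r) k ≡ M r k ^ᴹ q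
  M-* zero    r k = refl
  M-* (suc q) r k = trans (M-+ r (q ℕ.* r) k) (cong (M r k ⊗_) (M-* q r k))

  det : Mat → ℤ
  det (mat a b c d) = a * d - b * c

  det-step-⊗ : ∀ k X → det (step k ⊗ X) ≡ det X
  det-step-⊗ k (mat a b c d) = expanded k a b c d
    where
    expanded : ∀ k a b c d → (k * a + (- + 1) * c) * (+ 1 * b + + 0 * d) - (k * b + (- + 1) * d) * (+ 1 * a + + 0 * c)
                          ≡ a * d - b * c
    expanded = solve-∀

  det-M : ∀ n k → det (M n k) ≡ + 1
  det-M zero    k = refl
  det-M (suc n) k = trans (det-step-⊗ k (M n k)) (det-M n k)

  infix 4 _≋_[mod_]
  record _≋_[mod_] (X Y : Mat) (N : ℕ) : Set where
    constructor mat-mod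
    field
      a-mod : Mat.a X ≡ Mat.a Y [mod N ]
      b-mod : Mat.b X ≡ Mat.b Y [mod N ]
      c-mod : Mat.c X ≡ Mat.c Y [mod N ]
      d-mod : Mat.d X ≡ Mat.d Y [mod N ]

  ≈[]⇒≋[mod] : ∀ {N X Y} → X ≈[ N ] Y → X ≋ Y [mod N ]
  ≈[]⇒≋[mod] (a , b , c , d) = mat-mod (≡[]⇒≡[mod] a) (≡[]⇒≡[mod] b) (≡[]⇒≡[mod] c) (≡[]⇒≡[mod] d)

  ≋[mod]⇒≈[] : ∀ {N X Y} → X ≋ Y [mod N ] → X ≈[ N ] Y
  ≋[mod]⇒≈[] (mat-mod a b c d) = ≡[mod]⇒≡[] a , ≡[mod]⇒≡[] b , ≡[mod]⇒≡[] c , ≡[mod]⇒≡[] d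

  ≡⇒≋[mod] : ∀ {N X Y} → X ≡ Y → X ≋ Y [mod N ]
  ≡⇒≋[mod] refl = mat-mod ≡[mod]-refl ≡[mod]-refl ≡[mod]-refl ≡[mod]-refl

  ≋[mod]-refl : ∀ {N X} → X ≋ X [mod N ]
  ≋[mod]-refl = ≡⇒≋[mod] refl

  ≋[mod]-sym : ∀ {N X Y} → X ≋ Y [mod N ] → Y ≋ X [mod N ]
  ≋[mod]-sym (mat-mod a b c d) = mat-mod (≡[mod]-sym a) (≡[mod]-sym b) (≡[mod]-sym c) (≡[mod]-sym d)

  ≋[mod]-trans : ∀ {N X Y Z} → X ≋ Y [mod N ] → Y ≋ Z [mod N ] → X ≋ Z [mod N ]
  ≋[mod]-trans (mat-mod a b c d) (mat-mod a′ b′ c′ d′) =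
    mat-mod (≡[mod]-trans a a′) (≡[mod]-trans b b′) (≡[mod]-trans c c′) (≡[mod]-trans d d′)

  ≋[mod]-setoid : ℕ → Setoid 0ℓ 0ℓ
  ≋[mod]-setoid N = record
    { Carrier = Mat
    ; _≈_ = _≋_[mod N ]
    ; isEquivalence = record { refl = ≋[mod]-refl ; sym = ≋[mod]-sym ; trans = ≋[mod]-trans }
    }

  module ≋[mod]-Reasoning (N : ℕ) = SetoidReasoning (≋[mod]-setoid N)

  ≋[mod]-weaken : ∀ {M N X Y} → M ℕ.∣ N → X ≋ Y [mod N ] → X ≋ Y [mod M ]
  ≋[mod]-weaken M∣N (mat-mod a b c d) =
    mat-mod (≡[mod]-weaken M∣N a) (≡[mod]-weaken M∣N b) (≡[mod]-weaken M∣N c) (≡[mod]-weaken M∣N d)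

  ≋[mod]-⊗ : ∀ {N X X′ Y Y′} → X ≋ X′ [mod N ] → Y ≋ Y′ [mod N ] → X ⊗ Y ≋ X′ ⊗ Y′ [mod N ]
  ≋[mod]-⊗ {X = mat _ _ _ _} {mat _ _ _ _} {mat _ _ _ _} {mat _ _ _ _} (mat-mod a b c d) (mat-mod e f g h) =
    mat-mod (≡[mod]-+ (≡[mod]-* a e) (≡[mod]-* b g)) (≡[mod]-+ (≡[mod]-* a f) (≡[mod]-* b h))
            (≡[mod]-+ (≡[mod]-* c e) (≡[mod]-* d g)) (≡[mod]-+ (≡[mod]-* c f) (≡[mod]-* d h))

  infix 4 _≋±Id[mod_]
  _≋±Id[mod_] : Mat → ℕ → Set
  X ≋±Id[mod N ] = X ≋ Id [mod N ] ⊎ X ≋ negId [mod N ]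

  ≋±Id-⊗ : ∀ {N X Y} → X ≋±Id[mod N ] → Y ≋±Id[mod N ] → X ⊗ Y ≋±Id[mod N ]
  ≋±Id-⊗ (inj₁ x) (inj₁ y) = inj₁ (≋[mod]-⊗ x y)
  ≋±Id-⊗ (inj₁ x) (inj₂ y) = inj₂ (≋[mod]-⊗ x y)
  ≋±Id-⊗ (inj₂ x) (inj₁ y) = inj₂ (≋[mod]-⊗ x y)
  ≋±Id-⊗ (inj₂ x) (inj₂ y) = inj₁ (≋[mod]-⊗ x y)

  ≋±Id-^ᴹ : ∀ {N X} q → X ≋±Id[mod N ] → X ^ᴹ q ≋±Id[mod N ]
  ≋±Id-^ᴹ zero    _  = inj₁ ≋[mod]-refl
  ≋±Id-^ᴹ (suc q) X± = ≋±Id-⊗ X± (≋±Id-^ᴹ q X±)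

  ≋±Id-resp : ∀ {N X Y} → X ≋ Y [mod N ] → Y ≋±Id[mod N ] → X ≋±Id[mod N ]
  ≋±Id-resp X≋Y (inj₁ h) = inj₁ (≋[mod]-trans X≋Y h)
  ≋±Id-resp X≋Y (inj₂ h) = inj₂ (≋[mod]-trans X≋Y h)

  ≋±Id-weaken : ∀ {M N X} → M ℕ.∣ N → X ≋±Id[mod N ] → X ≋±Id[mod M ]
  ≋±Id-weaken M∣N (inj₁ h) = inj₁ (≋[mod]-weaken M∣N h)
  ≋±Id-weaken M∣N (inj₂ h) = inj₂ (≋[mod]-weaken M∣N h)

  ≋±Id⇒square≋Id : ∀ {N X} → X ≋±Id[mod N ] → X ⊗ X ≋ Id [mod N ]
  ≋±Id⇒square≋Id (inj₁ h) = ≋[mod]-⊗ h h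
  ≋±Id⇒square≋Id (inj₂ h) = ≋[mod]-⊗ h h

  ≋±Id-cancelʳ : ∀ {N} X Y → X ⊗ Y ≋±Id[mod N ] → Y ≋±Id[mod N ] → X ≋±Id[mod N ]
  ≋±Id-cancelʳ {N} X Y XY Y± = ≋±Id-resp X≋XYY (≋±Id-⊗ XY Y±)
    where
    X≋XYY : X ≋ (X ⊗ Y) ⊗ Y [mod N ]
    X≋XYY = begin
      X           ≡⟨ ⊗-identityʳ X ⟨
      X ⊗ Id      ≈⟨ ≋[mod]-⊗ (≋[mod]-refl {X = X}) (≋[mod]-sym (≋±Id⇒square≋Id Y±)) ⟩
      X ⊗ (Y ⊗ Y) ≡⟨ ⊗-assoc X Y Y ⟨
      (X ⊗ Y) ⊗ Y ∎
      where open ≋[mod]-Reasoning N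

  -- Lifting scalar matrices from N to q N

  scalar : ℤ → Mat
  scalar e = mat e (+ 0) (+ 0) e

  infix 6 _·Id+_·_
  _·Id+_·_ : ℤ → ℤ → Mat → Mat
  s ·Id+ t · mat a b c d = mat (s + t * a) (t * b) (t * c) (s + t * d)

  ≋scalar⇒·Id+· : ∀ {N e X} → X ≋ scalar e [mod N ] → Σ Mat λ Y → X ≡ e ·Id+ + N · Y
  ≋scalar⇒·Id+· {X = mat _ _ _ _} (mat-mod a≡e b≡0 c≡0 d≡e)
    with ≡[mod]⇒≡+* a≡e | ≡[mod]⇒≡+* b≡0 | ≡[mod]⇒≡+* c≡0 | ≡[mod]⇒≡+* d≡e
  ... | qa , a≡ | qb , b≡ | qc , c≡ | qd , d≡ =
    mat qa qb qc qd , mat-cong a≡ (trans b≡ (ℤ.+-identityˡ _)) (trans c≡ (ℤ.+-identityˡ _)) d≡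

  ·Id+·≋scalar : ∀ {L} s t Y → + L Signed.∣ t → s ·Id+ t · Y ≋ scalar s [mod L ]
  ·Id+·≋scalar s t (mat a b c d) L∣t = mat-mod
    (≡[mod]-by-multiple a L∣t refl) (≡[mod]-by-multiple b L∣t (sym (ℤ.+-identityˡ _)))
    (≡[mod]-by-multiple c L∣t (sym (ℤ.+-identityˡ _))) (≡[mod]-by-multiple d L∣t refl)

  ·Id+·-⊗ : ∀ {L} s t s′ t′ Y → + L Signed.∣ t * t′ →
            (s ·Id+ t · Y) ⊗ (s′ ·Id+ t′ · Y) ≋ (s * s′) ·Id+ (s * t′ + t * s′) · Y [mod L ]
  ·Id+·-⊗ s t s′ t′ (mat a b c d) L∣tt′ = mat-mod
    (≡[mod]-by-multiple (a * a + b * c) L∣tt′ (a-entry s t s′ t′ a b c))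
    (≡[mod]-by-multiple (a * b + b * d) L∣tt′ (b-entry s t s′ t′ a b d))
    (≡[mod]-by-multiple (c * a + d * c) L∣tt′ (c-entry s t s′ t′ a c d))
    (≡[mod]-by-multiple (c * b + d * d) L∣tt′ (d-entry s t s′ t′ b c d))
    where
    a-entry : ∀ s t s′ t′ a b c → (s + t * a) * (s′ + t′ * a) + (t * b) * (t′ * c)
                                  ≡ s * s′ + (s * t′ + t * s′) * a + t * t′ * (a * a + b * c)
    a-entry = solve-∀
    b-entry : ∀ s t s′ t′ a b d → (s + t * a) * (t′ * b) + (t * b) * (s′ + t′ * d)
                                  ≡ (s * t′ + t * s′) * b + t * t′ * (a * b + b * d)
    b-entry = solve-∀
    c-entry : ∀ s t s′ t′ a c d → (t * c) * (s′ + t′ * a) + (s + t * d) * (t′ * c)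
                                  ≡ (s * t′ + t * s′) * c + t * t′ * (c * a + d * c)
    c-entry = solve-∀
    d-entry : ∀ s t s′ t′ b c d → (t * c) * (t′ * b) + (s + t * d) * (s′ + t′ * d)
                                  ≡ s * s′ + (s * t′ + t * s′) * d + t * t′ * (c * b + d * d)
    d-entry = solve-∀

  ·Id+·-^ : ∀ e N Y j →
            (e ·Id+ + N · Y) ^ᴹ suc j ≋ (e ^ suc j) ·Id+ (+ suc j * e ^ j * + N) · Y [mod N ℕ.* N ]
  ·Id+·-^ e N Y zero = ≡⇒≋[mod] (begin
    (e ·Id+ + N · Y) ⊗ Id                   ≡⟨ ⊗-identityʳ _ ⟩
    e ·Id+ + N · Y                          ≡⟨ cong₂ (_·Id+_· Y) (ℤ.*-identityʳ e) (ℤ.*-identityˡ (+ N)) ⟨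
    (e ^ 1) ·Id+ (+ 1 * e ^ 0 * + N) · Y    ∎)
    where open ≡-Reasoning
  ·Id+·-^ e N Y (suc j) = begin
    A ⊗ A ^ᴹ suc j
      ≈⟨ ≋[mod]-⊗ (≋[mod]-refl {X = A}) (·Id+·-^ e N Y j) ⟩
    A ⊗ ((e ^ suc j) ·Id+ t · Y)
      ≈⟨ ·Id+·-⊗ e (+ N) (e ^ suc j) t Y N²∣N*t ⟩
    (e * e ^ suc j) ·Id+ (e * t + + N * e ^ suc j) · Y
      ≡⟨ cong (e ^ suc (suc j) ·Id+_· Y) coefficient ⟩
    (e ^ suc (suc j)) ·Id+ (+ suc (suc j) * e ^ suc j * + N) · Y ∎
    where
    open ≋[mod]-Reasoning (N ℕ.* N)
    A : Mat
    A = e ·Id+ + N · Y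
    t : ℤ
    t = + suc j * e ^ j * + N
    N²∣N*t : + (N ℕ.* N) Signed.∣ + N * t
    N²∣N*t = Signed.divides (+ suc j * e ^ j) (trans (square-form (+ N) (+ suc j * e ^ j)) (cong (_*_ (+ suc j * e ^ j)) (sym (ℤ.pos-* N N))))
      where
      square-form : ∀ n u → n * (u * n) ≡ u * (n * n)
      square-form = solve-∀
    coefficient : e * t + + N * e ^ suc j ≡ + suc (suc j) * e ^ suc j * + N
    coefficient = trans (expand e (e ^ j) (+ N) (+ suc j)) (cong (λ J → J * e ^ suc j * + N) (sym (ℤ.pos-+ 1 (suc j))))
      where
      expand : ∀ e f n J → e * (J * f * n) + n * (e * f) ≡ (+ 1 + J) * (e * f) * n
      expand = solve-∀

  ≋scalar-^ : ∀ {N e X} q → q ℕ.∣ N → X ≋ scalar e [mod N ] → X ^ᴹ q ≋ scalar (e ^ q) [mod q ℕ.* N ]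
  ≋scalar-^ zero    _   _   = ≋[mod]-refl
  ≋scalar-^ {N} {e} (suc j) q∣N X≋e with ≋scalar⇒·Id+· X≋e
  ... | Y , refl = begin
    (e ·Id+ + N · Y) ^ᴹ suc j                      ≈⟨ ≋[mod]-weaken (ℕ.*-monoˡ-∣ N q∣N) (·Id+·-^ e N Y j) ⟩
    (e ^ suc j) ·Id+ (+ suc j * e ^ j * + N) · Y   ≈⟨ ·Id+·≋scalar (e ^ suc j) _ Y qN∣t ⟩
    scalar (e ^ suc j)                             ∎
    where
    open ≋[mod]-Reasoning (suc j ℕ.* N)
    qN∣t : + (suc j ℕ.* N) Signed.∣ + suc j * e ^ j * + N
    qN∣t = Signed.divides (e ^ j) (trans (reorder (+ suc j) (e ^ j) (+ N)) (cong (_*_ (e ^ j)) (sym (ℤ.pos-* (suc j) N))))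
      where
      reorder : ∀ q f n → q * f * n ≡ f * (q * n)
      reorder = solve-∀

  ±1-^ : ∀ {e} n → e ≡ + 1 ⊎ e ≡ - + 1 → e ^ n ≡ + 1 ⊎ e ^ n ≡ - + 1
  ±1-^ zero    _ = inj₁ refl
  ±1-^ (suc n) e≡±1 with e≡±1 | ±1-^ n e≡±1
  ... | inj₁ refl | inj₁ eq = inj₁ (cong (_*_ (+ 1)) eq)
  ... | inj₁ refl | inj₂ eq = inj₂ (cong (_*_ (+ 1)) eq)
  ... | inj₂ refl | inj₁ eq = inj₂ (cong (_*_ (- + 1)) eq)
  ... | inj₂ refl | inj₂ eq = inj₁ (cong (_*_ (- + 1)) eq)

  ≋scalar±1⇒≋±Id : ∀ {N e X} → e ≡ + 1 ⊎ e ≡ - + 1 → X ≋ scalar e [mod N ] → X ≋±Id[mod N ]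
  ≋scalar±1⇒≋±Id (inj₁ refl) = inj₁
  ≋scalar±1⇒≋±Id (inj₂ refl) = inj₂

  ≋±Id-^ : ∀ {N X} q → q ℕ.∣ N → X ≋±Id[mod N ] → X ^ᴹ q ≋±Id[mod q ℕ.* N ]
  ≋±Id-^ q q∣N (inj₁ X≋Id)    = ≋scalar±1⇒≋±Id (±1-^ q (inj₁ refl)) (≋scalar-^ q q∣N X≋Id)
  ≋±Id-^ q q∣N (inj₂ X≋negId) = ≋scalar±1⇒≋±Id (±1-^ q (inj₂ refl)) (≋scalar-^ q q∣N X≋negId)

  -- Square roots of Id modulo odd prime powers

  square≋Id⇒≋±Id : ∀ {p} n X → Prime p → ¬ 2 ℕ.∣ p → det X ≡ + 1 →
                   X ⊗ X ≋ Id [mod p ℕ.^ suc n ] → X ≋±Id[mod p ℕ.^ suc n ]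
  square≋Id⇒≋±Id {p} n (mat a b c d) p-prime 2∤p ad-bc≡1 (mat-mod aa+bc≡1 ab+bd≡0 ca+dc≡0 cb+dd≡1)
    = Sum.map scalar-by-a scalar-by-a (square≡1⇒≡±1 (suc n) p-prime 2∤p a²≡1)
    where
    open ≡[mod]-Reasoning (p ℕ.^ suc n)
    a*[a+d]≡2 : a * (a + d) ≡ + 2 [mod p ℕ.^ suc n ]
    a*[a+d]≡2 = begin
      a * (a + d)                       ≡⟨ solve (a ∷ b ∷ c ∷ d ∷ []) ⟩
      (a * a + b * c) + (a * d - b * c) ≈⟨ ≡[mod]-+ aa+bc≡1 (≡⇒≡[mod] ad-bc≡1) ⟩
      + 2                               ∎
    d*[a+d]≡2 : d * (a + d) ≡ + 2 [mod p ℕ.^ suc n ]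
    d*[a+d]≡2 = begin
      d * (a + d)                       ≡⟨ solve (a ∷ b ∷ c ∷ d ∷ []) ⟩
      (c * b + d * d) + (a * d - b * c) ≈⟨ ≡[mod]-+ cb+dd≡1 (≡⇒≡[mod] ad-bc≡1) ⟩
      + 2                               ∎
    p∤a+d : ¬ + p Signed.∣ (a + d)
    p∤a+d p∣a+d = odd-prime∤2 p-prime 2∤p
      (subst (+ p Signed.∣_) (x-[x-2]≡2 (a * (a + d))) (Signed.∣m∣n⇒∣m-n (Signed.∣n⇒∣m*n a p∣a+d) p∣a*[a+d]-2))
      where
      x-[x-2]≡2 : ∀ x → x - (x - + 2) ≡ + 2
      x-[x-2]≡2 = solve-∀
      p∣a*[a+d]-2 : + p Signed.∣ a * (a + d) - + 2
      p∣a*[a+d]-2 = N∣x-y (≡[mod]-weaken (ℕ.m∣m*n (p ℕ.^ n)) a*[a+d]≡2)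
    cancel-a+d : ∀ {x y} → (a + d) * x ≡ (a + d) * y [mod p ℕ.^ suc n ] → x ≡ y [mod p ℕ.^ suc n ]
    cancel-a+d = ≡[mod]-*-cancelˡ (suc n) p-prime p∤a+d
    b≡0 : b ≡ + 0 [mod p ℕ.^ suc n ]
    b≡0 = cancel-a+d (begin
      (a + d) * b   ≡⟨ solve (a ∷ b ∷ d ∷ []) ⟩
      a * b + b * d ≈⟨ ab+bd≡0 ⟩
      + 0           ≡⟨ ℤ.*-zeroʳ (a + d) ⟨
      (a + d) * + 0 ∎)
    c≡0 : c ≡ + 0 [mod p ℕ.^ suc n ]
    c≡0 = cancel-a+d (begin
      (a + d) * c   ≡⟨ solve (a ∷ c ∷ d ∷ []) ⟩
      c * a + d * c ≈⟨ ca+dc≡0 ⟩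
      + 0           ≡⟨ ℤ.*-zeroʳ (a + d) ⟨
      (a + d) * + 0 ∎)
    a≡d : a ≡ d [mod p ℕ.^ suc n ]
    a≡d = cancel-a+d (begin
      (a + d) * a ≡⟨ ℤ.*-comm (a + d) a ⟩
      a * (a + d) ≈⟨ a*[a+d]≡2 ⟩
      + 2         ≈⟨ d*[a+d]≡2 ⟨
      d * (a + d) ≡⟨ ℤ.*-comm d (a + d) ⟩
      (a + d) * d ∎)
    a²≡1 : a * a ≡ + 1 [mod p ℕ.^ suc n ]
    a²≡1 = begin
      a * a                   ≈⟨ ≡[mod]-* (≡[mod]-refl {x = a}) a≡d ⟩
      a * d                   ≡⟨ solve (a ∷ b ∷ c ∷ d ∷ []) ⟩
      (a * d - b * c) + b * c ≈⟨ ≡[mod]-+ (≡⇒≡[mod] ad-bc≡1) (≡[mod]-* b≡0 c≡0) ⟩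
      + 1                     ∎
    scalar-by-a : ∀ {e} → a ≡ e [mod p ℕ.^ suc n ] → mat a b c d ≋ scalar e [mod p ℕ.^ suc n ]
    scalar-by-a a≡e = mat-mod a≡e b≡0 c≡0 (≡[mod]-trans (≡[mod]-sym a≡d) a≡e)

  Solves⇒≋±Id : ∀ {N} k n → Solves N k n → M n k ≋±Id[mod N ]
  Solves⇒≋±Id k n (inj₁ h) = inj₁ (≈[]⇒≋[mod] h)
  Solves⇒≋±Id k n (inj₂ h) = inj₂ (≈[]⇒≋[mod] h)

  ≋±Id⇒Solves : ∀ {N} k n → M n k ≋±Id[mod N ] → Solves N k n
  ≋±Id⇒Solves k n (inj₁ h) = inj₁ (≋[mod]⇒≈[] h)
  ≋±Id⇒Solves k n (inj₂ h) = inj₂ (≋[mod]⇒≈[] h)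

  Solves-weaken : ∀ {M N} k n → M ℕ.∣ N → Solves N k n → Solves M k n
  Solves-weaken k n M∣N = ≋±Id⇒Solves k n ∘ ≋±Id-weaken M∣N ∘ Solves⇒≋±Id k n

  Solves-* : ∀ {N} k q r → Solves N k r → Solves N k (q ℕ.* r)
  Solves-* {N} k q r r-solves = ≋±Id⇒Solves k (q ℕ.* r)
    (subst (_≋±Id[mod N ]) (sym (M-* q r k)) (≋±Id-^ᴹ q (Solves⇒≋±Id k r r-solves)))

  Solves-lift : ∀ {N} k q r → q ℕ.∣ N → Solves N k r → Solves (q ℕ.* N) k (q ℕ.* r)
  Solves-lift {N} k q r q∣N r-solves = ≋±Id⇒Solves k (q ℕ.* r)
    (subst (_≋±Id[mod q ℕ.* N ]) (sym (M-* q r k)) (≋±Id-^ q q∣N (Solves⇒≋±Id k r r-solves)))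

  Solves-cancelʳ : ∀ {N} k m n → Solves N k (m ℕ.+ n) → Solves N k n → Solves N k m
  Solves-cancelʳ {N} k m n m+n-solves n-solves = ≋±Id⇒Solves k m (≋±Id-cancelʳ (M m k) (M n k)
    (subst (_≋±Id[mod N ]) (M-+ m n k) (Solves⇒≋±Id k (m ℕ.+ n) m+n-solves)) (Solves⇒≋±Id k n n-solves))

  Solves-halve : ∀ {p} n k q → Prime p → ¬ 2 ℕ.∣ p →
                 M (q ℕ.+ q) k ≈[ p ℕ.^ suc n ] Id → Solves (p ℕ.^ suc n) k q
  Solves-halve n k q p-prime 2∤p M[q+q]≈Id = ≋±Id⇒Solves k q (square≋Id⇒≋±Id n (M q k) p-prime 2∤p (det-M q k)
    (subst (_≋ Id [mod _ ]) (M-+ q q k) (≈[]⇒≋[mod] M[q+q]≈Id)))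

-- Minimal sizes

open IntegerMatrices
open import Data.Integer.Base using (ℤ)
open import Data.Nat.Base using (_+_; _*_; _^_; _%_; _/_; _≤_; _<_; s≤s; z≤n; >-nonZero)
open import Data.Nat.Divisibility using (_∣_; divides)
open import Data.Nat.DivMod using (m≡m%n+[m/n]*n; m%n<n; %-distribˡ-+; [m+kn]%n≡m%n; m*n%n≡0)
open import Data.Nat.Primality using (prime[2])
open import Data.Nat.Tactic.RingSolver using (solve-∀)
open import Function.Bundles using (_⇔_; mk⇔)

below-minimal-size⇒0 : ∀ {N k r} t → MinSize N k r → t < r → Solves N k t → t ≡ 0
below-minimal-size⇒0 zero    _                 _   _        = refl
below-minimal-size⇒0 (suc t) (_ , _ , minimal) t<r t-solves = ⊥-elim (minimal (suc t) (s≤s z≤n) t<r t-solves)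

minimal-size-∣ : ∀ {N} k {r} m → MinSize N k r → Solves N k m → r ∣ m
minimal-size-∣ {N} k {r} m r-min@(1≤r , r-solves , _) m-solves =
  divides (m / r) (trans (m≡m%n+[m/n]*n m r) (cong (_+ m / r * r) remainder≡0))
  where
  instance _ = >-nonZero 1≤r
  remainder-solves : Solves N k (m % r)
  remainder-solves = Solves-cancelʳ k (m % r) (m / r * r)
    (subst (Solves N k) (m≡m%n+[m/n]*n m r) m-solves) (Solves-* k (m / r) r r-solves)
  remainder≡0 : m % r ≡ 0
  remainder≡0 = below-minimal-size⇒0 (m % r) r-min (m%n<n m r) remainder-solves

minimal-size-quotient : ∀ {N N′} k {r s} q → N ∣ N′ → MinSize N k r → MinSize N′ k s →
                        Solves N′ k (q * r) → Σ ℕ λ d → d ∣ q × s ≡ d * r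
minimal-size-quotient k {r} {s} q N∣N′ r-min@(1≤r , _) s-min@(_ , s-solves , _) qr-solves =
  let divides d s≡d*r = minimal-size-∣ k s r-min (Solves-weaken k s N∣N′ s-solves)
  in d , ℕ.*-cancelʳ-∣ r (subst (_∣ q * r) s≡d*r (minimal-size-∣ k (q * r) s-min qr-solves)) , s≡d*r
  where instance _ = >-nonZero 1≤r

minimal-size-lift : ∀ {p N} k {r s} → Prime p → p ∣ N → MinSize N k r → MinSize (p * N) k s →
                    s ≡ r ⊎ s ≡ p * r
minimal-size-lift {p} k {r} p-prime p∣N r-min@(_ , r-solves , _) s-min =
  let d , d∣p , s≡d*r = minimal-size-quotient k p (ℕ.n∣m*n p) r-min s-min (Solves-lift k p r p∣N r-solves)
  in Sum.map (λ d≡1 → trans s≡d*r (trans (cong (_* r) d≡1) (ℕ.*-identityˡ r)))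
             (λ d≡p → trans s≡d*r (cong (_* r) d≡p))
             (prime⇒irreducible p-prime d∣p)

even-minimal-size⇒≈negId : ∀ {p} n k {r} → Prime p → ¬ 2 ∣ p → MinSize (p ^ suc n) k r → 2 ∣ r →
                           M r k ≈[ p ^ suc n ] negId
even-minimal-size⇒≈negId n k p-prime 2∤p (_ , inj₂ r≈negId , _) _ = r≈negId
even-minimal-size⇒≈negId n k {r} p-prime 2∤p (1≤r , inj₁ r≈Id , minimal) (divides q r≡q*2) =
  ⊥-elim (minimal q 1≤q q<r (Solves-halve n k q p-prime 2∤p (subst (λ m → M m k ≈[ _ ] Id) r≡q+q r≈Id)))
  where
  r≡q+q : r ≡ q + q
  r≡q+q = trans r≡q*2 (trans (ℕ.*-comm q 2) (cong (q +_) (ℕ.+-identityʳ q)))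
  1≤q : 1 ≤ q
  1≤q = ℕ.n≢0⇒n>0 (λ q≡0 → ℕ.<⇒≢ 1≤r (sym (trans r≡q+q (cong (λ x → x + x) q≡0))))
  q<r : q < r
  q<r = subst (q <_) (sym r≡q+q) (ℕ.m<m+n q 1≤q)

Solves-prime-power : ∀ {p} k h n → Solves p k h → Solves (p ^ suc n) k (p ^ n * h)
Solves-prime-power {p} k h zero h-solves =
  subst₂ (λ N m → Solves N k m) (sym (ℕ.*-identityʳ p)) (sym (ℕ.+-identityʳ h)) h-solves
Solves-prime-power {p} k h (suc n) h-solves =
  subst (Solves (p ^ suc (suc n)) k) (sym (ℕ.*-assoc p (p ^ n) h))
        (Solves-lift k p (p ^ n * h) (ℕ.m∣m*n (p ^ n)) (Solves-prime-power k h n h-solves))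

2∣p^n⇒2∣p : ∀ {p} n → 2 ∣ p ^ n → 2 ∣ p
2∣p^n⇒2∣p zero 2∣1 with ℕ.∣1⇒≡1 2∣1
... | ()
2∣p^n⇒2∣p {p} (suc n) 2∣p^[1+n] with euclidsLemma p (p ^ n) prime[2] 2∣p^[1+n]
... | inj₁ 2∣p   = 2∣p
... | inj₂ 2∣p^n = 2∣p^n⇒2∣p n 2∣p^n

minimal-size-odd-multiple : ∀ {p} n k {h r} → Prime p → ¬ 2 ∣ p → MinSize p k h → MinSize (p ^ suc n) k r →
                            Σ ℕ λ d → ¬ 2 ∣ d × r ≡ d * h
minimal-size-odd-multiple {p} n k {h} p-prime 2∤p h-min@(_ , h-solves , _) r-min =
  let d , d∣p^n , r≡d*h = minimal-size-quotient k (p ^ n) (ℕ.m∣m*n (p ^ n)) h-min r-min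
                                                (Solves-prime-power k h n h-solves)
  in d , (λ 2∣d → 2∤p (2∣p^n⇒2∣p n (ℕ.∣-trans 2∣d d∣p^n))) , r≡d*h

odd*≡±[mod4] : ∀ d h → ¬ 2 ∣ d → (d * h) % 4 ≡ h % 4 ⊎ (d * h + h) % 4 ≡ 0
odd*≡±[mod4] d h 2∤d = subst (λ d → (d * h) % 4 ≡ h % 4 ⊎ (d * h + h) % 4 ≡ 0) (sym d≡u+f*4)
  (by-residue (d % 4) (d / 4) (m%n<n d 4) (subst (λ d → ¬ 2 ∣ d) d≡u+f*4 2∤d))
  where
  d≡u+f*4 : d ≡ d % 4 + d / 4 * 4
  d≡u+f*4 = m≡m%n+[m/n]*n d 4
  by-residue : ∀ u f → u < 4 → ¬ 2 ∣ u + f * 4 →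
               ((u + f * 4) * h) % 4 ≡ h % 4 ⊎ ((u + f * 4) * h + h) % 4 ≡ 0
  by-residue 0 f _ 2∤f*4 = ⊥-elim (2∤f*4 (divides (f * 2) (even-0 f)))
    where
    even-0 : ∀ f → 0 + f * 4 ≡ f * 2 * 2
    even-0 = solve-∀
  by-residue 1 f _ _ = inj₁ (trans (cong (_% 4) (residue-1 f h)) ([m+kn]%n≡m%n h (f * h) 4))
    where
    residue-1 : ∀ f h → (1 + f * 4) * h ≡ h + f * h * 4
    residue-1 = solve-∀
  by-residue 2 f _ 2∤2+f*4 = ⊥-elim (2∤2+f*4 (divides (1 + f * 2) (even-2 f)))
    where
    even-2 : ∀ f → 2 + f * 4 ≡ (1 + f * 2) * 2
    even-2 = solve-∀
  by-residue 3 f _ _ = inj₂ (trans (cong (_% 4) (residue-3 f h)) (m*n%n≡0 (h + f * h) 4))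
    where
    residue-3 : ∀ f h → (3 + f * 4) * h + h ≡ (h + f * h) * 4
    residue-3 = solve-∀
  by-residue (suc (suc (suc (suc _)))) _ (s≤s (s≤s (s≤s (s≤s ())))) _

[2+v]%4≡0⇒v≡2 : ∀ v → v < 4 → (2 + v) % 4 ≡ 0 → v ≡ 2
[2+v]%4≡0⇒v≡2 0 _ ()
[2+v]%4≡0⇒v≡2 1 _ ()
[2+v]%4≡0⇒v≡2 2 _ _ = refl
[2+v]%4≡0⇒v≡2 3 _ ()
[2+v]%4≡0⇒v≡2 (suc (suc (suc (suc _)))) (s≤s (s≤s (s≤s (s≤s ())))) _

[r+h]%4≡0⇒r≡2⇒h≡2 : ∀ r h → (r + h) % 4 ≡ 0 → r % 4 ≡ 2 → h % 4 ≡ 2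
[r+h]%4≡0⇒r≡2⇒h≡2 r h r+h≡0 r≡2 = [2+v]%4≡0⇒v≡2 (h % 4) (m%n<n h 4) (begin
  (2 + h % 4) % 4     ≡⟨ cong (λ x → (x + h % 4) % 4) r≡2 ⟨
  (r % 4 + h % 4) % 4 ≡⟨ %-distribˡ-+ r h 4 ⟨
  (r + h) % 4         ≡⟨ r+h≡0 ⟩
  0                   ∎)
  where open ≡-Reasoning

≡±[mod4]⇒≡2⇔≡2 : ∀ r h → r % 4 ≡ h % 4 ⊎ (r + h) % 4 ≡ 0 → (r % 4 ≡ 2 ⇔ h % 4 ≡ 2)
≡±[mod4]⇒≡2⇔≡2 r h (inj₁ r≡h) = mk⇔ (trans (sym r≡h)) (trans r≡h)
≡±[mod4]⇒≡2⇔≡2 r h (inj₂ r+h≡0) =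
  mk⇔ ([r+h]%4≡0⇒r≡2⇒h≡2 r h r+h≡0) ([r+h]%4≡0⇒r≡2⇒h≡2 h r (trans (cong (_% 4) (ℕ.+-comm h r)) r+h≡0))

minimal-size-≡±[mod4] : ∀ {p} n k {h r} → Prime p → ¬ 2 ∣ p → MinSize p k h → MinSize (p ^ suc n) k r →
                        r % 4 ≡ h % 4 ⊎ (r + h) % 4 ≡ 0
minimal-size-≡±[mod4] n k {h} p-prime 2∤p h-min r-min =
  let d , 2∤d , r≡d*h = minimal-size-odd-multiple n k p-prime 2∤p h-min r-min
  in subst (λ r → r % 4 ≡ h % 4 ⊎ (r + h) % 4 ≡ 0) (sym r≡d*h) (odd*≡±[mod4] d h 2∤d)

mainTheorem10 : (p : ℕ) → Prime p → (k : ℤ) → (n : ℕ) → 1 ≤ n → (r : ℕ) →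
    MinSize (p ^ n) k r →
      ((s : ℕ) → MinSize (p ^ (n + 1)) k s → (s ≡ r) ⊎ (s ≡ p * r))
      × (¬ (2 ∣ p) → 2 ∣ r → M r k ≈[ p ^ n ] negId)
      × ((h : ℕ) → MinSize p k h → ¬ (2 ∣ p) →
          ((r % 4 ≡ h % 4) ⊎ ((r + h) % 4 ≡ 0))
          × ((r % 4 ≡ 2) ⇔ (h % 4 ≡ 2)))
mainTheorem10 p p-prime k (suc n) _ r r-min =
    (λ s s-min → minimal-size-lift k p-prime (ℕ.m∣m*n (p ^ n)) r-min
                   (subst (λ N → MinSize N k s) (cong (p ^_) (ℕ.+-comm (suc n) 1)) s-min))
  , (λ 2∤p 2∣r → even-minimal-size⇒≈negId n k p-prime 2∤p r-min 2∣r)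
  , λ h h-min 2∤p → let r≡±h = minimal-size-≡±[mod4] n k p-prime 2∤p h-min r-min
                    in r≡±h , ≡±[mod4]⇒≡2⇔≡2 r h r≡±h
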